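{- Let $Q$ be a set of snapshots and $C\in\mathrm{dom}(Q)$. Then $C$ is finalized in $Q$ if and only if $C$ belongs to the domain of some finalized subset of $Q$.
   Context: A refob is a triple $(x,A,B)$ of a token $x$, owner actor $A$ and target actor $B$, written $x: A\to B$. A fact is one of $\mathrm{Created}(x)$, $\mathrm{Released}(x)$, $\mathrm{CreatedUsing}(x,y)$, $\mathrm{Activated}(x)$, $\mathrm{Unreleased}(x)$, $\mathrm{SentCount}(x,n)$, $\mathrm{RecvCount}(x,n)$ ($n\in\mathbb N$). A knowledge set $\Phi$ is a finite set of facts; $\Phi\vdash\varphi$ means $\varphi$ is derivable from $\Phi$ in first-order logic plus the rules: if no $\mathrm{SentCount}(x,n)\in\Phi$ then $\Phi\vdash\mathrm{SentCount}(x,0)$; if no $\mathrm{RecvCount}(x,n)\in\Phi$ then $\Phi\vdash\mathrm{RecvCount}(x,0)$; if $\Phi\vdash\mathrm{Created}(x)$ and $\Phi\not\vdash\mathrm{Released}(x)$ then $\Phi\vdash\mathrm{Unreleased}(x)$; if $\Phi\vdash\mathrm{CreatedUsing}(x,y)$ then $\Phi\vdash\mathrm{Created}(y)$. A set of snapshots $Q$ is a finite partial map from actors to knowledge sets; a subset of $Q$ is a restriction of $Q$ to a subset of $\mathrm{dom}(Q)$. For a refob $x:A\to B$: $Q\vdash\mathrm{Activated}(x)$, $Q\vdash\mathrm{SentCount}(x,n)$, $Q\vdash\mathrm{CreatedUsing}(x,y)$ mean $A\in\mathrm{dom}(Q)$ and $Q(A)$ derives the fact; $Q\vdash\mathrm{Created}(x)$,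 $Q\vdash\mathrm{Released}(x)$, $Q\vdash\mathrm{RecvCount}(x,n)$ mean $B\in\mathrm{dom}(Q)$ and $Q(B)$ derives the fact. $Q\vdash\mathrm{Chain}(x:A\to B)$ iff there are refobs $x_1:A_1\to B,\dots,x_n:A_n\to B$ with $Q\vdash\mathrm{Created}(x_1)$, $Q\not\vdash\mathrm{Released}(x_1)$, for all $i<n$ $Q\vdash\mathrm{CreatedUsing}(x_i,x_{i+1})$ and $Q\not\vdash\mathrm{Released}(x_{i+1})$, and $A_n=A$, $x_n=x$. $Q\vdash\mathrm{Relevant}(x)$ iff for some $n$, $Q\vdash\mathrm{Activated}(x)$, $Q\vdash\mathrm{SentCount}(x,n)$ and $Q\vdash\mathrm{RecvCount}(x,n)$. $Q$ is finalized if for all $B\in\mathrm{dom}(Q)$ and all refobs $x:A\to B$, $Q\vdash\mathrm{Chain}(x)$ implies $A\in\mathrm{dom}(Q)$ and $Q\vdash\mathrm{Relevant}(x)$. $B$ depends on $A$ in $Q$ if $A=B$ or there is a sequence of refobs $x_1:A_1\to A_2,\dots,x_{n-1}:A_{n-1}\to A_n$ ($n\ge2$) with $A_1=A$, $A_n=B$ and $Q\vdash\mathrm{Chain}(x_i)$ for each $i<n$. An actor $C$ is finalized in $Q$ if for every $B$ on which $C$ depends in $Q$ and every refob $x:A\to B$, $Q\vdash\mathrm{Chain}(x)$ implies $Q\vdash\mathrm{Relevant}(x)$. -}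

module Defs where

open import Data.Nat using (ℕ; zero)
open import Data.List using (List)
open import Data.List.Membership.Propositional using (_∈_)
open import Data.Product using (Σ; ∃; _×_; _,_)
open import Data.Sum using (_⊎_)
open import Data.Empty using (⊥)
open import Relation.Nullary using (¬_)
open import Relation.Binary.PropositionalEquality using (_≡_)

module Model (Token Actor : Set) where

  record Refob : Set where
    constructor _∶_⇒_
    field
      token  : Token
      owner  : Actor
      target : Actor
  open Refob public

  data Fact : Set where
    Created     : Refob → Fact
    Released    : Refob → Fact
    CreatedUsing : Refob → Refob → Fact
    Activated   : Refob → Fact
    Unreleased  : Refob → Fact
    SentCount   : Refob → ℕ → Fact
    RecvCount   : Refob → ℕ → Fact

  KnowledgeSet : Set
  KnowledgeSet = List Fact

  -- Derivability, stratified: ⊢₀ uses membership (first-order consequence of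
  -- a set of ground atoms), the default-count rules and the CreatedUsing rule;
  -- ⊢ additionally has the (negation-as-failure) Unreleased rule.
  data _⊢₀_ (Φ : KnowledgeSet) : Fact → Set where
    member : ∀ {φ} → φ ∈ Φ → Φ ⊢₀ φ
    sent0  : ∀ {x} → (∀ n → ¬ (SentCount x n ∈ Φ)) → Φ ⊢₀ SentCount x 0
    recv0  : ∀ {x} → (∀ n → ¬ (RecvCount x n ∈ Φ)) → Φ ⊢₀ RecvCount x 0
    using→created : ∀ {x y} → Φ ⊢₀ CreatedUsing x y → Φ ⊢₀ Created y

  data _⊢_ (Φ : KnowledgeSet) : Fact → Set where
    base  : ∀ {φ} → Φ ⊢₀ φ → Φ ⊢ φ
    unrel : ∀ {x} → Φ ⊢₀ Created x → ¬ (Φ ⊢₀ Released x) → Φ ⊢ Unreleased x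
    using→created : ∀ {x y} → Φ ⊢ CreatedUsing x y → Φ ⊢ Created y

  -- A set of snapshots: a finite partial map from actors to knowledge sets,
  -- represented by a domain predicate, the knowledge sets (only meaningful on
  -- the domain) and a finite list covering the domain.
  record Snapshots : Set₁ where
    field
      Dom    : Actor → Set
      K      : Actor → KnowledgeSet
      finite : Σ (List Actor) λ as → ∀ {A} → Dom A → A ∈ as
  open Snapshots public

  restrict : Snapshots → (Actor → Set) → Snapshots
  restrict Q S = record
    { Dom    = λ A → Dom Q A × S A
    ; K      = K Q
    ; finite = let (as , p) = finite Q in as , λ { (d , _) → p d } }

  at : Snapshots → Actor → Fact → Set
  at Q A φ = Dom Q A × (K Q A ⊢ φ)

  _⊩_ : Snapshots → Fact → Set
  Q ⊩ Activated x      = at Q (owner x) (Activated x)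
  Q ⊩ SentCount x n    = at Q (owner x) (SentCount x n)
  Q ⊩ CreatedUsing x y = at Q (owner x) (CreatedUsing x y)
  Q ⊩ Created x        = at Q (target x) (Created x)
  Q ⊩ Released x       = at Q (target x) (Released x)
  Q ⊩ RecvCount x n    = at Q (target x) (RecvCount x n)
  Q ⊩ Unreleased x     = ⊥   -- not defined (and not used) in the paper

  data ChainTo (Q : Snapshots) (B : Actor) : Refob → Set where
    start : ∀ {x₁} → target x₁ ≡ B → Q ⊩ Created x₁ → ¬ (Q ⊩ Released x₁) →
            ChainTo Q B x₁
    step  : ∀ {xᵢ x} → ChainTo Q B xᵢ → target x ≡ B →
            Q ⊩ CreatedUsing xᵢ x → ¬ (Q ⊩ Released x) → ChainTo Q B x

  Chain : Snapshots → Refob → Set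
  Chain Q x = ChainTo Q (target x) x

  Relevant : Snapshots → Refob → Set
  Relevant Q x = ∃ λ n → Q ⊩ Activated x × Q ⊩ SentCount x n × Q ⊩ RecvCount x n

  Finalized : Snapshots → Set
  Finalized Q = ∀ B → Dom Q B → ∀ (x : Refob) → target x ≡ B → Chain Q x →
                Dom Q (owner x) × Relevant Q x

  data DependsOn (Q : Snapshots) (B : Actor) : Actor → Set where
    here : DependsOn Q B B
    link : ∀ {x : Refob} → Chain Q x → DependsOn Q B (target x) →
           DependsOn Q B (owner x)

  ActorFinalized : Snapshots → Actor → Set
  ActorFinalized Q C = ∀ B → DependsOn Q C B → ∀ (x : Refob) → target x ≡ B →
                       Chain Q x → Relevant Q x

{-# OPTIONS --safe #-}
-- For ⇒, the actors on which C depends form a finalized subset containing C.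
-- For ⇐, a finalized subset R of Q sees every chain of Q towards one of its
-- actors (finality puts the owner of each link in R), so R contains every
-- actor on which one of its members depends, and relevance in R is relevance
-- in Q.
module Submission where

open import Defs
open import Data.Product using (Σ; _×_; _,_; proj₁; proj₂)
open import Function.Base using (_∘_)
open import Function.Bundles using (_⇔_; mk⇔)
open import Relation.Binary.PropositionalEquality using (_≡_; refl)

module _ {Token Actor : Set} where
  open Model Token Actor

  chainTo-target : ∀ {Q B x} → ChainTo Q B x → target x ≡ B
  chainTo-target (start e _ _)  = e
  chainTo-target (step _ e _ _) = e

  relevant⇒dom-owner : ∀ {Q x} → Relevant Q x → Dom Q (owner x)
  relevant⇒dom-owner (_ , (d , _) , _) = d

  finalized-chainTo : ∀ {Q B x} → Finalized Q → Dom Q B → ChainTo Q B x →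
                      Dom Q (owner x) × Relevant Q x
  finalized-chainTo F dB ch with refl ← chainTo-target ch = F _ dB _ refl ch

  module _ {Q : Snapshots} {S : Actor → Set} where

    at-restrict⁻ : ∀ {A φ} → at (restrict Q S) A φ → at Q A φ
    at-restrict⁻ ((d , _) , p) = d , p

    at-restrict⁺ : ∀ {A φ} → S A → at Q A φ → at (restrict Q S) A φ
    at-restrict⁺ s (d , p) = (d , s) , p

    relevant-restrict⁻ : ∀ {x} → Relevant (restrict Q S) x → Relevant Q x
    relevant-restrict⁻ (n , a , s , r) =
      n , at-restrict⁻ a , at-restrict⁻ s , at-restrict⁻ r

    relevant-restrict⁺ : ∀ {x} → S (owner x) → S (target x) →
                         Relevant Q x → Relevant (restrict Q S) x
    relevant-restrict⁺ sA sB (n , a , s , r) =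
      n , at-restrict⁺ sA a , at-restrict⁺ sA s , at-restrict⁺ sB r

    chainTo-restrict⁻ : ∀ {B x} → S B → ChainTo (restrict Q S) B x → ChainTo Q B x
    chainTo-restrict⁻ s (start refl c nr) =
      start refl (at-restrict⁻ c) (nr ∘ at-restrict⁺ s)
    chainTo-restrict⁻ s (step ch refl u nr) =
      step (chainTo-restrict⁻ s ch) refl (at-restrict⁻ u) (nr ∘ at-restrict⁺ s)

    chainTo-restrict⁺ : Finalized (restrict Q S) → ∀ {B x} → Dom (restrict Q S) B →
                        ChainTo Q B x → ChainTo (restrict Q S) B x
    chainTo-restrict⁺ F (_ , s) (start refl c nr) =
      start refl (at-restrict⁺ s c) (nr ∘ at-restrict⁻)
    chainTo-restrict⁺ F dB (step ch refl u nr) =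
      step chR refl (at-restrict⁺ (proj₂ dOwner) u) (nr ∘ at-restrict⁻)
      where
      chR = chainTo-restrict⁺ F dB ch
      dOwner = proj₁ (finalized-chainTo F dB chR)

    finalized-restrict⇒dom-dependsOn : Finalized (restrict Q S) → ∀ {C A} →
      Dom (restrict Q S) C → DependsOn Q C A → Dom (restrict Q S) A
    finalized-restrict⇒dom-dependsOn F dC here = dC
    finalized-restrict⇒dom-dependsOn F dC (link ch dep) =
      proj₁ (F _ dB _ refl (chainTo-restrict⁺ F dB ch))
      where dB = finalized-restrict⇒dom-dependsOn F dC dep

    finalized-restrict⇒actorFinalized : Finalized (restrict Q S) → ∀ {C} →
      Dom (restrict Q S) C → ActorFinalized Q C
    finalized-restrict⇒actorFinalized F dC _ dep x refl ch =
      relevant-restrict⁻ (proj₂ (F _ dB x refl (chainTo-restrict⁺ F dB ch)))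
      where dB = finalized-restrict⇒dom-dependsOn F dC dep

  actorFinalized⇒finalized-dependsOn : ∀ {Q C} → ActorFinalized Q C →
                                       Finalized (restrict Q (DependsOn Q C))
  actorFinalized⇒finalized-dependsOn {Q} {C} AF _ (_ , dep) x refl ch =
    (relevant⇒dom-owner {Q = Q} rel , depOwner) ,
    relevant-restrict⁺ {Q = Q} {S = DependsOn Q C} depOwner dep rel
    where
    chQ : Chain Q x
    chQ = chainTo-restrict⁻ dep ch
    rel : Relevant Q x
    rel = AF _ dep x refl chQ
    depOwner : DependsOn Q C (owner x)
    depOwner = link chQ dep

lemma7p6 : {Token Actor : Set} → let open Model Token Actor in
    (Q : Snapshots) (C : Actor) → Dom Q C →
    ActorFinalized Q C ⇔ Σ (Actor → Set) (λ S → Dom (restrict Q S) C × Finalized (restrict Q S))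
lemma7p6 {Token} {Actor} Q C dC = mk⇔
  (λ AF → DependsOn Q C , (dC , here) , actorFinalized⇒finalized-dependsOn AF)
  (λ (_ , dC∈S , F) → finalized-restrict⇒actorFinalized F dC∈S)
  where open Model Token Actor
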